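{- Let $k\ge 2$ and let $N$ be a finite set with $|N|=n$ and $\log_2 n\ge k$. Let $p$ be the unique positive integer with $pk\le\lfloor\log_2 n\rfloor\le (p+1)k-1$, let $\mathcal{V}=\{v\in\mathbb{Z}_+^k\mid \sum_{i=1}^k v_i=pk-k+1\}$, and choose distinct elements $e_v\in N$ for $v\in\mathcal{V}$. Let $f_1,\ldots,f_k:2^N\to\mathbb{R}_+$ be monotone submodular with $f_i(\emptyset)=0$. For $i\in[k]$ and $j\in[pk-k+1]$ let $N_i^j=\{e_v\mid v\in\mathcal{V},\ v_i\ge j\}$, and let $N^c=N\setminus\{e_v\mid v\in\mathcal{V}\}$. Define $z_i\in\mathbb{R}_+^{2^N}$ by: $z_1(S)=\frac{1}{pk-k+1}$ if $S=N_1^j\cup N^c$ for some $j\in[pk-k+1]$; for $2\le i\le k$, $z_i(S)=\frac{1}{pk-k+1}$ if $S=N_i^j$ for some $j\in[pk-k+1]$; and $z_i(S)=0$ otherwise. Then $(z_1,\ldots,z_k)$ is a feasible solution to \textsc{Mono-LP-Rel}.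
   Context: $[k]=\{1,\ldots,k\}$; $\mathbb{Z}_+$ is the nonnegative integers; $\chi_S$ is the characteristic vector of $S\subseteq N$ and $\mathbf{1}$ the all-ones vector in $\mathbb{R}^N$. \textsc{Mono-LP-Rel} for monotone submodular $f_1,\ldots,f_k$: minimize $\sum_{S\subseteq N,\,i\in[k]} y_i(S) f_i(S)$ subject to $y_i\in\mathbb{R}_+^{2^N}$ for all $i\in[k]$ and $\sum_{S\subseteq N,\,i\in[k]} y_i(S)\chi_S=\mathbf{1}$. (In the paper the $f_i$ are specific functions, but feasibility does not depend on them.) -}

module Defs where

open import Data.Bool using (Bool; true; false; if_then_else_; _∧_; _∨_)
open import Data.Nat as ℕ using (ℕ; zero; suc; _+_; _*_; _∸_; _≤ᵇ_; _≡ᵇ_)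
open import Data.Fin using (Fin; toℕ)
open import Data.Fin.Subset using (Subset; Side; inside; outside; _∪_)
open import Data.List using (List; []; _∷_; [_]; map; _++_; concatMap; filterᵇ; foldr; allFin; upTo)
open import Data.Bool.ListAction using (any)
open import Data.Vec as Vec using (Vec; []; _∷_; lookup; tabulate)
open import Data.Integer using (+_)
open import Data.Rational using (ℚ; 0ℚ; 1ℚ; _/_; _≤_) renaming (_+_ to _+ℚ_; _*_ to _*ℚ_)
open import Relation.Binary.PropositionalEquality using (_≡_)
open import Data.Product using (_×_)

Σℚ : List ℚ → ℚ
Σℚ = foldr _+ℚ_ 0ℚ

allSubsets : (n : ℕ) → List (Subset n)
allSubsets zero = [ [] ]
allSubsets (suc n) = map (outside ∷_) (allSubsets n) ++ map (inside ∷_) (allSubsets n)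

χ : ∀ {n} → Subset n → Fin n → ℚ
χ S x with lookup S x
... | inside = 1ℚ
... | outside = 0ℚ

MonoLPFeasible : (k n : ℕ) → (Fin k → Subset n → ℚ) → Set
MonoLPFeasible k n y =
  ((i : Fin k) (S : Subset n) → 0ℚ ≤ y i S) ×
  ((x : Fin n) →
     Σℚ (concatMap (λ S → map (λ i → y i S *ℚ χ S x) (allFin k)) (allSubsets n)) ≡ 1ℚ)

boundedVecs : (k b : ℕ) → List (Vec ℕ k)
boundedVecs zero b = [ [] ]
boundedVecs (suc k) b = concatMap (λ a → map (a ∷_) (boundedVecs k b)) (upTo (suc b))

-- 𝒱 = { v ∈ ℤ₊^k | Σ v_i = m }, enumerated (every such v has entries ≤ m)
𝒱 : (k m : ℕ) → List (Vec ℕ k)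
𝒱 k m = filterᵇ (λ v → Vec.sum v ≡ᵇ m) (boundedVecs k m)

In𝒱 : (k m : ℕ) → Vec ℕ k → Set
In𝒱 k m v = Vec.sum v ≡ m

_==F_ : ∀ {n} → Fin n → Fin n → Bool
a ==F b = toℕ a ≡ᵇ toℕ b

toSide : Bool → Side
toSide true = inside
toSide false = outside

Nij : ∀ {n} (k m : ℕ) → (Vec ℕ k → Fin n) → Fin k → ℕ → Subset n
Nij k m e i j = tabulate λ x → toSide (any (λ v → (j ≤ᵇ lookup v i) ∧ (e v ==F x)) (𝒱 k m))

Nc : ∀ {n} (k m : ℕ) → (Vec ℕ k → Fin n) → Subset n
Nc k m e = tabulate λ x → toSide (Data.Bool.not (any (λ v → e v ==F x) (𝒱 k m)))
  where import Data.Bool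

_==S_ : ∀ {n} → Subset n → Subset n → Bool
[] ==S [] = true
(inside ∷ S) ==S (inside ∷ T) = S ==S T
(outside ∷ S) ==S (outside ∷ T) = S ==S T
(inside ∷ S) ==S (outside ∷ T) = false
(outside ∷ S) ==S (inside ∷ T) = false

range1 : ℕ → List ℕ
range1 m = map suc (upTo m)

-- z_i(S) with m = pk - k + 1 (passed as suc m' so that 1/m is defined):
--   z_1(S) = 1/m if S = N_1^j ∪ N^c for some j ∈ [m]
--   z_i(S) = 1/m if S = N_i^j for some j ∈ [m]   (2 ≤ i ≤ k)
--   z_i(S) = 0 otherwise
z : ∀ {n} (k m' : ℕ) → (Vec ℕ k → Fin n) → Fin k → Subset n → ℚ
z k m' e i S =
  if any (λ j → S ==S target j) (range1 (suc m')) then (+ 1 / suc m') else 0ℚ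
  where
  target : ℕ → Subset _
  target j = if toℕ i ≡ᵇ 0 then Nij k (suc m') e i j ∪ Nc k (suc m') e
                           else Nij k (suc m') e i j

-- Write m = pk − k + 1 and Tᵢʲ (target i j) for the set with zᵢ(Tᵢʲ) = 1/m (so T₁ʲ = N₁ʲ ∪ Nᶜ and
-- Tᵢʲ = Nᵢʲ for i ≥ 2). Because k ≥ 2, every a ≤ m occurs as the i-th coordinate of
-- some v ∈ 𝒱, and then e_v ∈ Tᵢᵃ ∖ Tᵢᵇ for a < b; hence Tᵢ¹, …, Tᵢᵐ are distinct and the
-- covering constraint at x says that x lies in exactly m of the pairs (i, Tᵢʲ).
-- If x = e_v, then x ∈ Tᵢʲ iff j ≤ vᵢ, giving Σᵢ vᵢ = m pairs; otherwise x ∈ Nᶜ lies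
-- exactly in T₁¹, …, T₁ᵐ.

module Submission where

open import Defs
open import Algebra.Bundles using (CommutativeMonoid)
open import Data.Bool using (Bool; true; false; T; T?; not; _∧_; _∨_; if_then_else_)
open import Data.Bool.ListAction using (any)
open import Data.Bool.Properties using (T-≡; T-∧; ¬-not; ∧-zeroʳ; ∧-identityʳ; ∨-identityʳ)
open import Data.Empty using (⊥; ⊥-elim)
open import Data.Fin as Fin using (Fin; toℕ)
import Data.Fin.Properties as Fin
open import Data.Fin.Subset using (Subset; _∪_)
open import Data.Integer as ℤ using ()
import Data.Integer.Properties as ℤ
open import Data.List using (List; []; _∷_; map; _++_; _∷ʳ_; concatMap; allFin; length; upTo)
open import Data.List.Properties using (map-++; map-∘; map-tabulate; applyUpTo-∷ʳ; length-map; length-upTo)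
open import Data.List.Membership.Propositional using (_∈_; lose; find)
open import Data.List.Membership.Propositional.Properties
  using (∈-filter⁺; ∈-filter⁻; ∈-concatMap⁺; ∈-map⁺; ∈-upTo⁺)
open import Data.List.Relation.Unary.All as All using (All)
open import Data.List.Relation.Unary.All.Properties using (All¬⇒¬Any)
open import Data.List.Relation.Unary.AllPairs as AllPairs using (AllPairs; []; _∷_)
import Data.List.Relation.Unary.AllPairs.Properties as AllPairs
open import Data.List.Relation.Unary.Any as Any using (Any; here)
open import Data.List.Relation.Unary.Any.Properties using (any⁺; any⁻)
open import Data.Nat as ℕ using (ℕ; zero; suc; _∸_; _*_; _⊓_; _≤_; _<_; _≤ᵇ_; _≡ᵇ_; z≤n; s≤s)
import Data.Nat.Properties as ℕ
import Data.Nat.Coprimality as Coprime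
open import Data.Nat.Logarithm using (⌊log₂_⌋)
open import Data.Product using (∃-syntax; _×_; _,_; proj₂)
open import Data.Rational using (ℚ; mkℚ; 0ℚ; 1ℚ; _+_; _/_; 1/_) renaming (_*_ to _·_; _≤_ to _≤ℚ_)
import Data.Rational.Properties as ℚ
open import Data.Unit using (tt)
open import Data.Vec as Vec using (Vec; []; _∷_; lookup)
import Data.Vec.Properties as Vec
open import Function using (_∘_; Equivalence)
open import Relation.Binary.PropositionalEquality
  using (_≡_; _≢_; refl; cong; cong₂; trans; subst; module ≡-Reasoning)
  renaming (sym to ≡-sym)
open import Relation.Nullary using (¬_; Dec; yes; no)
open import Relation.Nullary.Reflects using (Reflects; ofʸ; ofⁿ)

open ≡-Reasoning
open import Algebra.Properties.CommutativeSemigroup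
  (CommutativeMonoid.commutativeSemigroup ℚ.+-0-commutativeMonoid)
  using () renaming (interchange to +-interchange)

fromℕ : ℕ → ℚ
fromℕ zero    = 0ℚ
fromℕ (suc n) = 1ℚ + fromℕ n

fromℕ-+ : ∀ a b → fromℕ (a ℕ.+ b) ≡ fromℕ a + fromℕ b
fromℕ-+ zero    b = ≡-sym (ℚ.+-identityˡ (fromℕ b))
fromℕ-+ (suc a) b = trans (cong (1ℚ +_) (fromℕ-+ a b)) (≡-sym (ℚ.+-assoc 1ℚ (fromℕ a) (fromℕ b)))

fromℕ≡n/1 : ∀ n → fromℕ n ≡ ℤ.+ n / 1
fromℕ≡n/1 zero    = refl
fromℕ≡n/1 (suc n) = begin
  1ℚ + fromℕ n                   ≡⟨ cong (1ℚ +_) (fromℕ≡n/1 n) ⟩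
  1ℚ + ℤ.+ n / 1                 ≡⟨ cong (1ℚ +_) (ℚ.normalize-coprime n/1-coprime) ⟩
  -- ℚ addition computes (1 · 1 + n · 1) / (1 · 1) before normalising
  1ℚ + mkℚ (ℤ.+ n) 0 n/1-coprime ≡⟨ ℚ./-cong (cong (ℤ._+_ (ℤ.+ 1)) (ℤ.*-identityʳ (ℤ.+ n))) refl ⟩
  ℤ.+ suc n / 1                  ∎
  where
  n/1-coprime : Coprime.Coprime n 1
  n/1-coprime = Coprime.sym (Coprime.1-coprimeTo n)

1/[1+m]·[1+m]≡1 : ∀ m → (ℤ.+ 1 / suc m) · fromℕ (suc m) ≡ 1ℚ
1/[1+m]·[1+m]≡1 m = begin
  (ℤ.+ 1 / suc m) · fromℕ (suc m)
    ≡⟨ cong₂ _·_ (ℚ.normalize-coprime (Coprime.1-coprimeTo (suc m)))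
                 (trans (fromℕ≡n/1 (suc m)) (ℚ.normalize-coprime [1+m]/1-coprime)) ⟩
  1/ [1+m] · [1+m]
    ≡⟨ ℚ.*-inverseˡ [1+m] ⟩
  1ℚ ∎
  where
  [1+m]/1-coprime : Coprime.Coprime (suc m) 1
  [1+m]/1-coprime = Coprime.sym (Coprime.1-coprimeTo (suc m))
  [1+m] : ℚ
  [1+m] = mkℚ (ℤ.+ suc m) 0 [1+m]/1-coprime

0≤1/[1+m] : ∀ m → 0ℚ ≤ℚ ℤ.+ 1 / suc m
0≤1/[1+m] m rewrite ℚ.normalize-coprime {1} {m} (Coprime.1-coprimeTo (suc m)) = ℚ.nonNegative⁻¹ _

𝟙 : Bool → ℚ
𝟙 true  = 1ℚ
𝟙 false = 0ℚ

χ≡𝟙∘lookup : ∀ {n} (S : Subset n) x → χ S x ≡ 𝟙 (lookup S x)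
χ≡𝟙∘lookup S x with lookup S x
... | true  = refl
... | false = refl

𝟙-∨ : ∀ b c → (T b → T c → ⊥) → 𝟙 (b ∨ c) ≡ 𝟙 b + 𝟙 c
𝟙-∨ true  true  not-both = ⊥-elim (not-both tt tt)
𝟙-∨ true  false _        = ≡-sym (ℚ.+-identityʳ 1ℚ)
𝟙-∨ false c     _        = ≡-sym (ℚ.+-identityˡ (𝟙 c))

𝟙-if : ∀ q b → (if b then q else 0ℚ) ≡ q · 𝟙 b
𝟙-if q true  = ≡-sym (ℚ.*-identityʳ q)
𝟙-if q false = ≡-sym (ℚ.*-zeroʳ q)

Σℚ-++ : (xs ys : List ℚ) → Σℚ (xs ++ ys) ≡ Σℚ xs + Σℚ ys
Σℚ-++ []       ys = ≡-sym (ℚ.+-identityˡ _)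
Σℚ-++ (x ∷ xs) ys = trans (cong (x +_) (Σℚ-++ xs ys)) (≡-sym (ℚ.+-assoc x _ _))

module _ {A : Set} where

  Σℚ-concatMap : (f : A → List ℚ) (xs : List A) →
                 Σℚ (concatMap f xs) ≡ Σℚ (map (Σℚ ∘ f) xs)
  Σℚ-concatMap f []       = refl
  Σℚ-concatMap f (x ∷ xs) = trans (Σℚ-++ (f x) (concatMap f xs)) (cong (Σℚ (f x) +_) (Σℚ-concatMap f xs))

  Σℚ-cong : {f g : A → ℚ} → (∀ x → f x ≡ g x) → (xs : List A) → Σℚ (map f xs) ≡ Σℚ (map g xs)
  Σℚ-cong f≗g []       = refl
  Σℚ-cong f≗g (x ∷ xs) = cong₂ _+_ (f≗g x) (Σℚ-cong f≗g xs)

  Σℚ-0 : (xs : List A) → Σℚ (map (λ _ → 0ℚ) xs) ≡ 0ℚ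
  Σℚ-0 []       = refl
  Σℚ-0 (_ ∷ xs) = trans (ℚ.+-identityˡ _) (Σℚ-0 xs)

  Σℚ-const : ∀ q (xs : List A) → Σℚ (map (λ _ → q) xs) ≡ fromℕ (length xs) · q
  Σℚ-const q []       = ≡-sym (ℚ.*-zeroˡ q)
  Σℚ-const q (_ ∷ xs) = begin
    q + Σℚ (map (λ _ → q) xs)      ≡⟨ cong₂ _+_ (≡-sym (ℚ.*-identityˡ q)) (Σℚ-const q xs) ⟩
    1ℚ · q + fromℕ (length xs) · q ≡⟨ ≡-sym (ℚ.*-distribʳ-+ q 1ℚ (fromℕ (length xs))) ⟩
    fromℕ (suc (length xs)) · q    ∎

  Σℚ-+ : (f g : A → ℚ) (xs : List A) →
         Σℚ (map (λ x → f x + g x) xs) ≡ Σℚ (map f xs) + Σℚ (map g xs)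
  Σℚ-+ f g []       = ≡-sym (ℚ.+-identityˡ 0ℚ)
  Σℚ-+ f g (x ∷ xs) = trans (cong (f x + g x +_) (Σℚ-+ f g xs)) (+-interchange (f x) (g x) _ _)

  Σℚ-·ˡ : ∀ q (f : A → ℚ) (xs : List A) → Σℚ (map (λ x → q · f x) xs) ≡ q · Σℚ (map f xs)
  Σℚ-·ˡ q f []       = ≡-sym (ℚ.*-zeroʳ q)
  Σℚ-·ˡ q f (x ∷ xs) = trans (cong (q · f x +_) (Σℚ-·ˡ q f xs)) (≡-sym (ℚ.*-distribˡ-+ q (f x) _))

  Σℚ-·ʳ : ∀ q (f : A → ℚ) (xs : List A) → Σℚ (map (λ x → f x · q) xs) ≡ Σℚ (map f xs) · q
  Σℚ-·ʳ q f xs = begin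
    Σℚ (map (λ x → f x · q) xs) ≡⟨ Σℚ-cong (λ x → ℚ.*-comm (f x) q) xs ⟩
    Σℚ (map (λ x → q · f x) xs) ≡⟨ Σℚ-·ˡ q f xs ⟩
    q · Σℚ (map f xs)           ≡⟨ ℚ.*-comm q _ ⟩
    Σℚ (map f xs) · q           ∎

  Σℚ-∷ʳ : (f : A → ℚ) (xs : List A) (x : A) → Σℚ (map f (xs ∷ʳ x)) ≡ Σℚ (map f xs) + f x
  Σℚ-∷ʳ f xs x = begin
    Σℚ (map f (xs ∷ʳ x))          ≡⟨ cong Σℚ (map-++ f xs (x ∷ [])) ⟩
    Σℚ (map f xs ++ f x ∷ [])     ≡⟨ Σℚ-++ (map f xs) (f x ∷ []) ⟩
    Σℚ (map f xs) + (f x + 0ℚ)    ≡⟨ cong (Σℚ (map f xs) +_) (ℚ.+-identityʳ (f x)) ⟩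
    Σℚ (map f xs) + f x           ∎

Σℚ-swap : ∀ {A B : Set} (h : A → B → ℚ) (xs : List A) (ys : List B) →
          Σℚ (map (λ x → Σℚ (map (h x) ys)) xs) ≡ Σℚ (map (λ y → Σℚ (map (λ x → h x y) xs)) ys)
Σℚ-swap h []       ys = ≡-sym (Σℚ-0 ys)
Σℚ-swap h (x ∷ xs) ys = trans (cong (Σℚ (map (h x) ys) +_) (Σℚ-swap h xs ys))
                              (≡-sym (Σℚ-+ (h x) (λ y → Σℚ (map (λ x′ → h x′ y) xs)) ys))

𝟙-any : ∀ {A : Set} (P : A → Bool) {xs : List A} →
        AllPairs (λ a b → T (P a) → T (P b) → ⊥) xs → 𝟙 (any P xs) ≡ Σℚ (map (𝟙 ∘ P) xs)
𝟙-any P []                               = refl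
𝟙-any P {x ∷ xs} (excl-x ∷ excl-xs) =
  trans (𝟙-∨ (P x) (any P xs) not-both) (cong (𝟙 (P x) +_) (𝟙-any P excl-xs))
  where
  not-both : T (P x) → T (any P xs) → ⊥
  not-both Px = All¬⇒¬Any (All.map (λ excl → excl Px) excl-x) ∘ any⁻ P xs

range1-∷ʳ : ∀ m → range1 (suc m) ≡ range1 m ∷ʳ suc m
range1-∷ʳ m = trans (cong (map suc) (≡-sym (applyUpTo-∷ʳ (λ j → j) m))) (map-++ suc (upTo m) (m ∷ []))

length-range1 : ∀ m → length (range1 m) ≡ m
length-range1 m = trans (length-map suc (upTo m)) (length-upTo m)

AllPairs-range1 : ∀ {R : ℕ → ℕ → Set} m → (∀ {a b} → a < b → b ≤ m → R a b) → AllPairs R (range1 m)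
AllPairs-range1 m R<≤ = AllPairs.map⁺ (AllPairs.applyUpTo⁺₁ (λ j → j) m (λ a<b b<m → R<≤ (s≤s a<b) b<m))

Σℚ-range1-≤ᵇ : ∀ m a → Σℚ (map (λ j → 𝟙 (j ≤ᵇ a)) (range1 m)) ≡ fromℕ (m ⊓ a)
Σℚ-range1-≤ᵇ zero    a = refl
Σℚ-range1-≤ᵇ (suc m) a = begin
  Σℚ (map [_≤a] (range1 (suc m)))        ≡⟨ cong (Σℚ ∘ map [_≤a]) (range1-∷ʳ m) ⟩
  Σℚ (map [_≤a] (range1 m ∷ʳ suc m))      ≡⟨ Σℚ-∷ʳ [_≤a] (range1 m) (suc m) ⟩
  Σℚ (map [_≤a] (range1 m)) + [ suc m ≤a] ≡⟨ cong (_+ [ suc m ≤a]) (Σℚ-range1-≤ᵇ m a) ⟩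
  fromℕ (m ⊓ a) + [ suc m ≤a]             ≡⟨ last-step (suc m ≤ᵇ a) (ℕ.≤ᵇ-reflects-≤ (suc m) a) ⟩
  fromℕ (suc m ⊓ a)                       ∎
  where
  [_≤a] : ℕ → ℚ
  [ j ≤a] = 𝟙 (j ≤ᵇ a)
  last-step : ∀ b → Reflects (suc m ≤ a) b → fromℕ (m ⊓ a) + 𝟙 b ≡ fromℕ (suc m ⊓ a)
  last-step true (ofʸ m<a) = begin
    fromℕ (m ⊓ a) + 1ℚ ≡⟨ cong (λ l → fromℕ l + 1ℚ) (ℕ.m≤n⇒m⊓n≡m (ℕ.<⇒≤ m<a)) ⟩
    fromℕ m + 1ℚ       ≡⟨ ℚ.+-comm (fromℕ m) 1ℚ ⟩
    fromℕ (suc m)      ≡⟨ cong fromℕ (≡-sym (ℕ.m≤n⇒m⊓n≡m m<a)) ⟩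
    fromℕ (suc m ⊓ a)  ∎
  last-step false (ofⁿ m≮a) = begin
    fromℕ (m ⊓ a) + 0ℚ ≡⟨ ℚ.+-identityʳ _ ⟩
    fromℕ (m ⊓ a)      ≡⟨ cong fromℕ (ℕ.m≥n⇒m⊓n≡n a≤m) ⟩
    fromℕ a            ≡⟨ cong fromℕ (≡-sym (ℕ.m≥n⇒m⊓n≡n (ℕ.m≤n⇒m≤1+n a≤m))) ⟩
    fromℕ (suc m ⊓ a)  ∎
    where
    a≤m : a ≤ m
    a≤m = ℕ.≮⇒≥ m≮a

==S-sound : ∀ {n} (S S′ : Subset n) → T (S ==S S′) → S ≡ S′
==S-sound []            []            _  = refl
==S-sound (true  ∷ S)   (true  ∷ S′)  eq = cong (true ∷_) (==S-sound S S′ eq)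
==S-sound (false ∷ S)   (false ∷ S′)  eq = cong (false ∷_) (==S-sound S S′ eq)

Σℚ-allSubsets-𝟙[==S] : ∀ n (S′ : Subset n) (g : Subset n → ℚ) →
                       Σℚ (map (λ S → 𝟙 (S ==S S′) · g S) (allSubsets n)) ≡ g S′
Σℚ-allSubsets-𝟙[==S] zero    []       g = trans (ℚ.+-identityʳ _) (ℚ.*-identityˡ (g []))
Σℚ-allSubsets-𝟙[==S] (suc n) (s ∷ S′) g = begin
  Σℚ (map h (map (false ∷_) L ++ map (true ∷_) L))
    ≡⟨ cong Σℚ (map-++ h (map (false ∷_) L) (map (true ∷_) L)) ⟩
  Σℚ (map h (map (false ∷_) L) ++ map h (map (true ∷_) L))
    ≡⟨ Σℚ-++ (map h (map (false ∷_) L)) _ ⟩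
  Σℚ (map h (map (false ∷_) L)) + Σℚ (map h (map (true ∷_) L))
    ≡⟨ cong₂ _+_ (cong Σℚ (≡-sym (map-∘ L))) (cong Σℚ (≡-sym (map-∘ L))) ⟩
  Σℚ (map (h ∘ (false ∷_)) L) + Σℚ (map (h ∘ (true ∷_)) L)
    ≡⟨ by-first-element s ⟩
  g (s ∷ S′) ∎
  where
  L : List (Subset n)
  L = allSubsets n
  h : Subset (suc n) → ℚ
  h S = 𝟙 (S ==S (s ∷ S′)) · g S
  Σℚ-0· : ∀ b → Σℚ (map (λ S → 0ℚ · g (b ∷ S)) L) ≡ 0ℚ
  Σℚ-0· b = trans (Σℚ-cong (λ S → ℚ.*-zeroˡ (g (b ∷ S))) L) (Σℚ-0 L)
  by-first-element : ∀ s → Σℚ (map (λ S → 𝟙 ((false ∷ S) ==S (s ∷ S′)) · g (false ∷ S)) L)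
                         + Σℚ (map (λ S → 𝟙 ((true ∷ S) ==S (s ∷ S′)) · g (true ∷ S)) L)
                         ≡ g (s ∷ S′)
  by-first-element true  = trans (cong₂ _+_ (Σℚ-0· false) (Σℚ-allSubsets-𝟙[==S] n S′ (g ∘ (true ∷_))))
                                 (ℚ.+-identityˡ _)
  by-first-element false = trans (cong₂ _+_ (Σℚ-allSubsets-𝟙[==S] n S′ (g ∘ (false ∷_))) (Σℚ-0· true))
                                 (ℚ.+-identityʳ _)

¬T⇒≡false : ∀ {b} → ¬ T b → b ≡ false
¬T⇒≡false ¬Tb = ¬-not (¬Tb ∘ Equivalence.from T-≡)

any-∧-unique : ∀ {A : Set} (q r : A → Bool) {v : A} {xs : List A} → v ∈ xs → T (r v) →
               (∀ {w} → w ∈ xs → T (r w) → w ≡ v) → any (λ w → q w ∧ r w) xs ≡ q v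
any-∧-unique q r {v} {xs} v∈xs rv unique with q v in qv
... | true  = Equivalence.to T-≡ (any⁺ _ (lose v∈xs (Equivalence.from T-∧ (subst T (≡-sym qv) tt , rv))))
... | false = ¬T⇒≡false λ T-any →
  let (w , w∈xs , T-qw∧rw) = find (any⁻ _ xs T-any)
      (qw , rw)            = Equivalence.to T-∧ T-qw∧rw
  in subst T qv (subst (T ∘ q) (unique w∈xs rw) qw)

any-∧-none : ∀ {A : Set} (q r : A → Bool) {xs : List A} → ¬ T (any r xs) → any (λ w → q w ∧ r w) xs ≡ false
any-∧-none q r {xs} ¬any-r = ¬T⇒≡false λ T-any →
  let (w , w∈xs , T-qw∧rw) = find (any⁻ _ xs T-any)
  in ¬any-r (any⁺ r (lose w∈xs (proj₂ (Equivalence.to T-∧ T-qw∧rw))))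

==F-sound : ∀ {n} (a b : Fin n) → T (a ==F b) → a ≡ b
==F-sound a b = Fin.toℕ-injective ∘ ℕ.≡ᵇ⇒≡ (toℕ a) (toℕ b)

==F-refl : ∀ {n} (a : Fin n) → T (a ==F a)
==F-refl a = ℕ.≡⇒≡ᵇ (toℕ a) (toℕ a) refl

toSide≡id : ∀ b → toSide b ≡ b
toSide≡id true  = refl
toSide≡id false = refl

lookup≤sum : ∀ {k} (v : Vec ℕ k) i → lookup v i ≤ Vec.sum v
lookup≤sum (x ∷ v) Fin.zero    = ℕ.m≤m+n x _
lookup≤sum (x ∷ v) (Fin.suc i) = ℕ.≤-trans (lookup≤sum v i) (ℕ.m≤n+m _ x)

boundedVecs-complete : ∀ k b (v : Vec ℕ k) → (∀ i → lookup v i ≤ b) → v ∈ boundedVecs k b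
boundedVecs-complete zero    b []      _   = here refl
boundedVecs-complete (suc k) b (x ∷ v) v≤b =
  ∈-concatMap⁺ (λ a → map (a ∷_) (boundedVecs k b))
    (Any.map (λ { refl → ∈-map⁺ (x ∷_) (boundedVecs-complete k b v (v≤b ∘ Fin.suc)) })
             (∈-upTo⁺ (s≤s (v≤b Fin.zero))))

module _ {k m : ℕ} where

  private
    P? : (v : Vec ℕ k) → Dec (T (Vec.sum v ≡ᵇ m))
    P? v = T? (Vec.sum v ≡ᵇ m)

  ∈𝒱⇒In𝒱 : ∀ {v} → v ∈ 𝒱 k m → In𝒱 k m v
  ∈𝒱⇒In𝒱 {v} v∈𝒱 = ℕ.≡ᵇ⇒≡ (Vec.sum v) m (proj₂ (∈-filter⁻ P? {xs = boundedVecs k m} v∈𝒱))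

  In𝒱⇒∈𝒱 : ∀ {v} → In𝒱 k m v → v ∈ 𝒱 k m
  In𝒱⇒∈𝒱 {v} sum≡m = ∈-filter⁺ P?
    (boundedVecs-complete k m v (λ i → subst (lookup v i ≤_) sum≡m (lookup≤sum v i)))
    (ℕ.≡⇒≡ᵇ (Vec.sum v) m sum≡m)

spike : ∀ {k} → Fin k → ℕ → Vec ℕ k
spike Fin.zero    a = a ∷ Vec.replicate _ 0
spike (Fin.suc i) a = 0 ∷ spike i a

sum-spike : ∀ {k} (i : Fin k) a → Vec.sum (spike i a) ≡ a
sum-spike {suc k} Fin.zero a = trans (cong (ℕ._+_ a) (sum-replicate-0 k)) (ℕ.+-identityʳ a)
  where
  sum-replicate-0 : ∀ k → Vec.sum (Vec.replicate k 0) ≡ 0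
  sum-replicate-0 zero    = refl
  sum-replicate-0 (suc k) = sum-replicate-0 k
sum-spike (Fin.suc i) a = sum-spike i a

lookup-spike : ∀ {k} (i : Fin k) a → lookup (spike i a) i ≡ a
lookup-spike Fin.zero    a = refl
lookup-spike (Fin.suc i) a = lookup-spike i a

In𝒱-attains : ∀ {k} m (i : Fin (2 ℕ.+ k)) {a} → a ≤ m → ∃[ v ] In𝒱 (2 ℕ.+ k) m v × lookup v i ≡ a
In𝒱-attains {k} m Fin.zero {a} a≤m =
  a ∷ spike Fin.zero (m ∸ a) , trans (cong (ℕ._+_ a) (sum-spike {suc k} Fin.zero (m ∸ a))) (ℕ.m+[n∸m]≡n a≤m) , refl
In𝒱-attains m (Fin.suc i) {a} a≤m =
  (m ∸ a) ∷ spike i a ,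
  trans (cong (ℕ._+_ (m ∸ a)) (sum-spike i a)) (trans (ℕ.+-comm (m ∸ a) a) (ℕ.m+[n∸m]≡n a≤m)) ,
  lookup-spike i a

Σℚ-allFin-suc : ∀ k (g : Fin (suc k) → ℚ) →
                Σℚ (map g (allFin (suc k))) ≡ g Fin.zero + Σℚ (map (g ∘ Fin.suc) (allFin k))
Σℚ-allFin-suc k g = cong (λ l → g Fin.zero + Σℚ l)
  (trans (map-tabulate Fin.suc g) (≡-sym (map-tabulate (λ i → i) (g ∘ Fin.suc))))

Σℚ-fromℕ∘lookup : ∀ k (v : Vec ℕ k) → Σℚ (map (fromℕ ∘ lookup v) (allFin k)) ≡ fromℕ (Vec.sum v)
Σℚ-fromℕ∘lookup zero    []      = refl
Σℚ-fromℕ∘lookup (suc k) (x ∷ v) = begin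
  Σℚ (map (fromℕ ∘ lookup (x ∷ v)) (allFin (suc k))) ≡⟨ Σℚ-allFin-suc k (fromℕ ∘ lookup (x ∷ v)) ⟩
  fromℕ x + Σℚ (map (fromℕ ∘ lookup v) (allFin k))  ≡⟨ cong (fromℕ x +_) (Σℚ-fromℕ∘lookup k v) ⟩
  fromℕ x + fromℕ (Vec.sum v)                       ≡⟨ ≡-sym (fromℕ-+ x (Vec.sum v)) ⟩
  fromℕ (x ℕ.+ Vec.sum v)                           ∎

Σℚ-allFin-𝟙[≡0] : ∀ k → Σℚ (map (λ i → 𝟙 (toℕ i ≡ᵇ 0)) (allFin (suc k))) ≡ 1ℚ
Σℚ-allFin-𝟙[≡0] k = begin
  Σℚ (map (λ i → 𝟙 (toℕ i ≡ᵇ 0)) (allFin (suc k))) ≡⟨ Σℚ-allFin-suc k (λ i → 𝟙 (toℕ i ≡ᵇ 0)) ⟩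
  1ℚ + Σℚ (map (λ _ → 0ℚ) (allFin k))            ≡⟨ cong (1ℚ +_) (Σℚ-0 (allFin k)) ⟩
  1ℚ + 0ℚ                                        ≡⟨ ℚ.+-identityʳ 1ℚ ⟩
  1ℚ                                             ∎

lookup-if-∪ : ∀ {n} b (A B : Subset n) x → lookup (if b then A ∪ B else A) x ≡ lookup A x ∨ (b ∧ lookup B x)
lookup-if-∪ true  A B x = Vec.lookup-zipWith _∨_ x A B
lookup-if-∪ false A B x = ≡-sym (∨-identityʳ (lookup A x))

module Feasibility {n : ℕ} (k m′ : ℕ) (e : Vec ℕ (2 ℕ.+ k) → Fin n)
  (e-injective : ∀ v w → In𝒱 (2 ℕ.+ k) (suc m′) v → In𝒱 (2 ℕ.+ k) (suc m′) w → e v ≡ e w → v ≡ w)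
  where

  private
    d : ℕ
    d = 2 ℕ.+ k
    m : ℕ
    m = suc m′
    c : ℚ
    c = ℤ.+ 1 / m
    𝒱ₘ : List (Vec ℕ d)
    𝒱ₘ = 𝒱 d m

  target : Fin d → ℕ → Subset n
  target i j = if toℕ i ≡ᵇ 0 then Nij d m e i j ∪ Nc d m e else Nij d m e i j

  inImage : Fin n → Bool
  inImage x = any (λ w → e w ==F x) 𝒱ₘ

  lookup-Nij-image : ∀ {v} → v ∈ 𝒱ₘ → ∀ i j → lookup (Nij d m e i j) (e v) ≡ (j ≤ᵇ lookup v i)
  lookup-Nij-image {v} v∈𝒱 i j = trans (Vec.lookup∘tabulate _ (e v)) (trans (toSide≡id _)
    (any-∧-unique (λ w → j ≤ᵇ lookup w i) (λ w → e w ==F e v) v∈𝒱 (==F-refl (e v))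
      (λ w∈𝒱 ew=ev → e-injective _ _ (∈𝒱⇒In𝒱 w∈𝒱) (∈𝒱⇒In𝒱 v∈𝒱) (==F-sound _ _ ew=ev))))

  lookup-Nc-image : ∀ {v} → v ∈ 𝒱ₘ → lookup (Nc d m e) (e v) ≡ false
  lookup-Nc-image {v} v∈𝒱 = trans (Vec.lookup∘tabulate _ (e v)) (trans (toSide≡id _)
    (cong not (Equivalence.to T-≡ (any⁺ _ (lose v∈𝒱 (==F-refl (e v)))))))

  lookup-Nij-outside : ∀ {x} → ¬ T (inImage x) → ∀ i j → lookup (Nij d m e i j) x ≡ false
  lookup-Nij-outside {x} ¬image i j = trans (Vec.lookup∘tabulate _ x) (trans (toSide≡id _)
    (any-∧-none (λ w → j ≤ᵇ lookup w i) (λ w → e w ==F x) {𝒱ₘ} ¬image))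

  lookup-Nc-outside : ∀ {x} → ¬ T (inImage x) → lookup (Nc d m e) x ≡ true
  lookup-Nc-outside {x} ¬image = trans (Vec.lookup∘tabulate _ x) (trans (toSide≡id _)
    (cong not (¬T⇒≡false ¬image)))

  lookup-target-image : ∀ {v} → v ∈ 𝒱ₘ → ∀ i j → lookup (target i j) (e v) ≡ (j ≤ᵇ lookup v i)
  lookup-target-image {v} v∈𝒱 i j = begin
    lookup (target i j) (e v)
      ≡⟨ lookup-if-∪ (toℕ i ≡ᵇ 0) _ _ (e v) ⟩
    lookup (Nij d m e i j) (e v) ∨ ((toℕ i ≡ᵇ 0) ∧ lookup (Nc d m e) (e v))
      ≡⟨ cong₂ (λ b b′ → b ∨ ((toℕ i ≡ᵇ 0) ∧ b′)) (lookup-Nij-image v∈𝒱 i j) (lookup-Nc-image v∈𝒱) ⟩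
    (j ≤ᵇ lookup v i) ∨ ((toℕ i ≡ᵇ 0) ∧ false)
      ≡⟨ cong ((j ≤ᵇ lookup v i) ∨_) (∧-zeroʳ _) ⟩
    (j ≤ᵇ lookup v i) ∨ false
      ≡⟨ ∨-identityʳ _ ⟩
    j ≤ᵇ lookup v i ∎

  lookup-target-outside : ∀ {x} → ¬ T (inImage x) → ∀ i j → lookup (target i j) x ≡ (toℕ i ≡ᵇ 0)
  lookup-target-outside {x} ¬image i j = begin
    lookup (target i j) x
      ≡⟨ lookup-if-∪ (toℕ i ≡ᵇ 0) _ _ x ⟩
    lookup (Nij d m e i j) x ∨ ((toℕ i ≡ᵇ 0) ∧ lookup (Nc d m e) x)
      ≡⟨ cong₂ (λ b b′ → b ∨ ((toℕ i ≡ᵇ 0) ∧ b′)) (lookup-Nij-outside ¬image i j) (lookup-Nc-outside ¬image) ⟩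
    (toℕ i ≡ᵇ 0) ∧ true
      ≡⟨ ∧-identityʳ _ ⟩
    toℕ i ≡ᵇ 0 ∎

  target-separated : ∀ {v} → v ∈ 𝒱ₘ → ∀ i {b} → lookup v i < b → target i (lookup v i) ≢ target i b
  target-separated {v} v∈𝒱 i {b} vᵢ<b same = ℕ.<⇒≱ vᵢ<b (ℕ.≤ᵇ⇒≤ b (lookup v i) b≤ᵇvᵢ)
    where
    b≤ᵇvᵢ : T (b ≤ᵇ lookup v i)
    b≤ᵇvᵢ = subst T (begin
      lookup v i ≤ᵇ lookup v i             ≡⟨ ≡-sym (lookup-target-image v∈𝒱 i (lookup v i)) ⟩
      lookup (target i (lookup v i)) (e v) ≡⟨ cong (λ S → lookup S (e v)) same ⟩
      lookup (target i b) (e v)            ≡⟨ lookup-target-image v∈𝒱 i b ⟩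
      b ≤ᵇ lookup v i                      ∎) (ℕ.≤⇒≤ᵇ (ℕ.≤-refl {lookup v i}))

  target-injective : ∀ i {a b} → a < b → b ≤ m → target i a ≢ target i b
  target-injective i {a} a<b b≤m with In𝒱-attains m i {a} (ℕ.<⇒≤ (ℕ.<-≤-trans a<b b≤m))
  ... | v , sum-v≡m , refl = target-separated {v} (In𝒱⇒∈𝒱 sum-v≡m) i a<b

  z≡c·Σ𝟙[==target] : ∀ i S → z d m′ e i S ≡ c · Σℚ (map (λ j → 𝟙 (S ==S target i j)) (range1 m))
  z≡c·Σ𝟙[==target] i S =
    trans (𝟙-if c _) (cong (c ·_) (𝟙-any (λ j → S ==S target i j) (AllPairs-range1 m not-both)))
    where
    not-both : ∀ {a b} → a < b → b ≤ m → T (S ==S target i a) → T (S ==S target i b) → ⊥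
    not-both a<b b≤m S≡ta S≡tb =
      target-injective i a<b b≤m (trans (≡-sym (==S-sound S _ S≡ta)) (==S-sound S _ S≡tb))

  coverage : Fin n → Fin d → ℚ
  coverage x i = Σℚ (map (λ j → 𝟙 (lookup (target i j) x)) (range1 m))

  Σ-z·χ≡c·coverage : ∀ x i → Σℚ (map (λ S → z d m′ e i S · χ S x) (allSubsets n)) ≡ c · coverage x i
  Σ-z·χ≡c·coverage x i = begin
    Σℚ (map (λ S → z d m′ e i S · χ S x) (allSubsets n))
      ≡⟨ Σℚ-cong z·χ≡ (allSubsets n) ⟩
    Σℚ (map (λ S → c · Σℚ (map (h S) (range1 m))) (allSubsets n))
      ≡⟨ Σℚ-·ˡ c (λ S → Σℚ (map (h S) (range1 m))) (allSubsets n) ⟩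
    c · Σℚ (map (λ S → Σℚ (map (h S) (range1 m))) (allSubsets n))
      ≡⟨ cong (c ·_) (Σℚ-swap h (allSubsets n) (range1 m)) ⟩
    c · Σℚ (map (λ j → Σℚ (map (λ S → h S j) (allSubsets n))) (range1 m))
      ≡⟨ cong (c ·_) (Σℚ-cong (λ j → Σℚ-allSubsets-𝟙[==S] n (target i j) (λ S → χ S x)) (range1 m)) ⟩
    c · Σℚ (map (λ j → χ (target i j) x) (range1 m))
      ≡⟨ cong (c ·_) (Σℚ-cong (λ j → χ≡𝟙∘lookup (target i j) x) (range1 m)) ⟩
    c · coverage x i ∎
    where
    h : Subset n → ℕ → ℚ
    h S j = 𝟙 (S ==S target i j) · χ S x
    z·χ≡ : ∀ S → z d m′ e i S · χ S x ≡ c · Σℚ (map (h S) (range1 m))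
    z·χ≡ S = begin
      z d m′ e i S · χ S x                                          ≡⟨ cong (_· χ S x) (z≡c·Σ𝟙[==target] i S) ⟩
      c · Σℚ (map (λ j → 𝟙 (S ==S target i j)) (range1 m)) · χ S x ≡⟨ ℚ.*-assoc c _ (χ S x) ⟩
      c · (Σℚ (map (λ j → 𝟙 (S ==S target i j)) (range1 m)) · χ S x)
        ≡⟨ cong (c ·_) (≡-sym (Σℚ-·ʳ (χ S x) (λ j → 𝟙 (S ==S target i j)) (range1 m))) ⟩
      c · Σℚ (map (h S) (range1 m))                                 ∎

  Σ-coverage-image : ∀ {v} → v ∈ 𝒱ₘ → Σℚ (map (coverage (e v)) (allFin d)) ≡ fromℕ m
  Σ-coverage-image {v} v∈𝒱 = begin
    Σℚ (map (coverage (e v)) (allFin d))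
      ≡⟨ Σℚ-cong (λ i → Σℚ-cong (λ j → cong 𝟙 (lookup-target-image v∈𝒱 i j)) (range1 m)) (allFin d) ⟩
    Σℚ (map (λ i → Σℚ (map (λ j → 𝟙 (j ≤ᵇ lookup v i)) (range1 m))) (allFin d))
      ≡⟨ Σℚ-cong (λ i → Σℚ-range1-≤ᵇ m (lookup v i)) (allFin d) ⟩
    Σℚ (map (λ i → fromℕ (m ⊓ lookup v i)) (allFin d))
      ≡⟨ Σℚ-cong (λ i → cong fromℕ (ℕ.m≥n⇒m⊓n≡n (vᵢ≤m i))) (allFin d) ⟩
    Σℚ (map (fromℕ ∘ lookup v) (allFin d))
      ≡⟨ Σℚ-fromℕ∘lookup d v ⟩
    fromℕ (Vec.sum v)
      ≡⟨ cong fromℕ (∈𝒱⇒In𝒱 v∈𝒱) ⟩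
    fromℕ m ∎
    where
    vᵢ≤m : ∀ i → lookup v i ≤ m
    vᵢ≤m i = subst (lookup v i ≤_) (∈𝒱⇒In𝒱 v∈𝒱) (lookup≤sum v i)

  Σ-coverage-outside : ∀ {x} → ¬ T (inImage x) → Σℚ (map (coverage x) (allFin d)) ≡ fromℕ m
  Σ-coverage-outside {x} ¬image = begin
    Σℚ (map (coverage x) (allFin d))
      ≡⟨ Σℚ-cong (λ i → Σℚ-cong (λ j → cong 𝟙 (lookup-target-outside ¬image i j)) (range1 m)) (allFin d) ⟩
    Σℚ (map (λ i → Σℚ (map (λ _ → [i≡0] i) (range1 m))) (allFin d))
      ≡⟨ Σℚ-cong (λ i → Σℚ-const ([i≡0] i) (range1 m)) (allFin d) ⟩
    Σℚ (map (λ i → fromℕ (length (range1 m)) · [i≡0] i) (allFin d))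
      ≡⟨ Σℚ-·ˡ (fromℕ (length (range1 m))) [i≡0] (allFin d) ⟩
    fromℕ (length (range1 m)) · Σℚ (map [i≡0] (allFin d))
      ≡⟨ cong₂ _·_ (cong fromℕ (length-range1 m)) (Σℚ-allFin-𝟙[≡0] (suc k)) ⟩
    fromℕ m · 1ℚ
      ≡⟨ ℚ.*-identityʳ (fromℕ m) ⟩
    fromℕ m ∎
    where
    [i≡0] : Fin d → ℚ
    [i≡0] i = 𝟙 (toℕ i ≡ᵇ 0)

  Σ-coverage : ∀ x → Σℚ (map (coverage x) (allFin d)) ≡ fromℕ m
  Σ-coverage x with T? (inImage x)
  ... | no ¬image = Σ-coverage-outside ¬image
  ... | yes image with find (any⁻ _ 𝒱ₘ image)
  ...   | v , v∈𝒱 , ev=x with ==F-sound (e v) x ev=x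
  ...     | refl = Σ-coverage-image v∈𝒱

  feasible : MonoLPFeasible d n (z d m′ e)
  feasible = nonnegative , covers-once
    where
    nonnegative : ∀ i S → 0ℚ ≤ℚ z d m′ e i S
    nonnegative i S with any (λ j → S ==S target i j) (range1 m)
    ... | true  = 0≤1/[1+m] m′
    ... | false = ℚ.≤-refl
    covers-once : ∀ x → Σℚ (concatMap (λ S → map (λ i → z d m′ e i S · χ S x) (allFin d)) (allSubsets n)) ≡ 1ℚ
    covers-once x = begin
      Σℚ (concatMap (λ S → map (λ i → z d m′ e i S · χ S x) (allFin d)) (allSubsets n))
        ≡⟨ Σℚ-concatMap (λ S → map (λ i → z d m′ e i S · χ S x) (allFin d)) (allSubsets n) ⟩
      Σℚ (map (λ S → Σℚ (map (λ i → z d m′ e i S · χ S x) (allFin d))) (allSubsets n))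
        ≡⟨ Σℚ-swap (λ S i → z d m′ e i S · χ S x) (allSubsets n) (allFin d) ⟩
      Σℚ (map (λ i → Σℚ (map (λ S → z d m′ e i S · χ S x) (allSubsets n))) (allFin d))
        ≡⟨ Σℚ-cong (Σ-z·χ≡c·coverage x) (allFin d) ⟩
      Σℚ (map (λ i → c · coverage x i) (allFin d))
        ≡⟨ Σℚ-·ˡ c (coverage x) (allFin d) ⟩
      c · Σℚ (map (coverage x) (allFin d))
        ≡⟨ cong (c ·_) (Σ-coverage x) ⟩
      c · fromℕ m
        ≡⟨ 1/[1+m]·[1+m]≡1 m′ ⟩
      1ℚ ∎

lemma6 : (k n p : ℕ) → 2 ≤ k → k ≤ ⌊log₂ n ⌋ →
         1 ≤ p → p * k ≤ ⌊log₂ n ⌋ → ⌊log₂ n ⌋ < suc p * k →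
         (e : Vec ℕ k → Fin n) →
         ((v w : Vec ℕ k) → In𝒱 k (suc (p * k ∸ k)) v → In𝒱 k (suc (p * k ∸ k)) w →
            e v ≡ e w → v ≡ w) →
         MonoLPFeasible k n (z k (p * k ∸ k) e)
lemma6 (suc (suc k)) n p (s≤s (s≤s z≤n)) _ _ _ _ e e-injective =
  Feasibility.feasible k (p * suc (suc k) ∸ suc (suc k)) e e-injective
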